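{- Let $n=2m$ and let $F$ be a proper subset of $[n]$. Let $\mathcal{D}_F$ denote the set of all chains between $F$ and $[n]$. Let $\mathcal{R}$ be a family of subsets of $[n]$ such that there are no 3 different sets $B,C,D\in\mathcal{R}$ with $B\subset D$ and $|B|=|C|$. For a set $X\subseteq[n]$ let $w(X)=\binom{n}{|X|}$, and define $$S(F)=\frac{1}{(n-|F|)!}\sum_{c\in\mathcal{D}_F}\ \sum_{\substack{X\in c\cap\mathcal{R}\\ F\subsetneq X\subsetneq[n]}} w(X).$$ Then: (i) if $|F|\ge m-1$, then $S(F)\le\binom{n}{|F|+1}$; (ii) if $|F|\le m-1$, then $S(F)\le\binom{n}{m}+\sum_{i=|F|+1}^{m-1}\frac{1}{n-i+1}\binom{n}{i}$.
   Context: $[n]=\{1,2,\dots,n\}$. For sets $A\subseteq B$, a chain between $A$ and $B$ is a family $A=C_{|A|}\subset C_{|A|+1}\subset\dots\subset C_{|B|}=B$ with $|C_i|=i$ for all $i$; there are $(|B|-|A|)!$ such chains. -}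

module Defs where

open import Data.Bool using (Bool; true; false)
import Data.Bool.Properties as BoolP
open import Data.Nat using (ℕ; zero; suc; _+_; _∸_)
open import Data.Nat.Properties using (_!≢0)
import Data.Nat.Properties as ℕP
open import Data.Nat.Combinatorics using (_C_)
open import Data.Nat using (_!)
open import Data.Integer using (+_)
open import Data.Rational using (ℚ; _/_; 0ℚ) renaming (_+_ to _+ℚ_)
open import Data.List using (List; []; _∷_; _++_; map; concatMap; filter; foldr; upTo)
open import Data.Nat.ListAction using (sum)
open import Data.Maybe using (Maybe; just; nothing)
import Data.Maybe.Properties as MaybeP
open import Data.Product using (_×_; _,_)
open import Data.Unit using (⊤; tt)
open import Data.Vec using ([]; _∷_)
import Data.Vec.Properties as VecP
open import Data.Fin.Subset using (Subset; inside; outside; _⊆_; _⊂_; ∣_∣) renaming (⊤ to full)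
open import Data.Fin.Subset.Properties using (_⊆?_; _⊂?_)
open import Relation.Binary.PropositionalEquality using (_≡_)
open import Relation.Binary.Definitions using (DecidableEquality)
open import Relation.Nullary using (Dec; yes; no)
open import Relation.Nullary.Decidable using (_×-dec_)
import Data.List as L

allSubsets : (n : ℕ) → List (Subset n)
allSubsets zero = [] ∷ []
allSubsets (suc n) = map (outside ∷_) (allSubsets n) ++ map (inside ∷_) (allSubsets n)

listsOf : {A : Set} → ℕ → List A → List (List A)
listsOf zero xs = [] ∷ []
listsOf (suc k) xs = concatMap (λ x → map (x ∷_) (listsOf k xs)) xs

_≟S_ : {n : ℕ} → DecidableEquality (Subset n)
_≟S_ = VecP.≡-dec BoolP._≟_

Step : {n : ℕ} → Subset n → Subset n → Set
Step X Y = X ⊆ Y × ∣ Y ∣ ≡ suc ∣ X ∣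

Path : {n : ℕ} → List (Subset n) → Set
Path [] = ⊤
Path (X ∷ []) = ⊤
Path (X ∷ Y ∷ cs) = Step X Y × Path (Y ∷ cs)

-- cs is a chain A = C_{|A|} ⊂ C_{|A|+1} ⊂ ... ⊂ C_{|B|} = B with |C_i| = i
IsChain : {n : ℕ} → Subset n → Subset n → List (Subset n) → Set
IsChain A B cs = L.head cs ≡ just A × L.last cs ≡ just B × Path cs

path? : {n : ℕ} (cs : List (Subset n)) → Dec (Path cs)
path? [] = yes tt
path? (X ∷ []) = yes tt
path? (X ∷ Y ∷ cs) = ((X ⊆? Y) ×-dec (∣ Y ∣ ℕP.≟ suc ∣ X ∣)) ×-dec path? (Y ∷ cs)

isChain? : {n : ℕ} (A B : Subset n) (cs : List (Subset n)) → Dec (IsChain A B cs)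
isChain? A B cs =
  MaybeP.≡-dec _≟S_ (L.head cs) (just A) ×-dec (MaybeP.≡-dec _≟S_ (L.last cs) (just B) ×-dec path? cs)

chains : (n : ℕ) → Subset n → List (List (Subset n))
chains n F = filter (isChain? F full) (listsOf (suc (n ∸ ∣ F ∣)) (allSubsets n))

w : (n : ℕ) → Subset n → ℕ
w n X = n C ∣ X ∣

innerSum : (n : ℕ) → (Subset n → Bool) → Subset n → List (Subset n) → ℕ
innerSum n R F c =
  sum (map (w n) (filter (λ X → (R X BoolP.≟ true) ×-dec ((F ⊂? X) ×-dec (X ⊂? full))) c))

S : (n : ℕ) → (Subset n → Bool) → Subset n → ℚ
S n R F = _/_ (+ sum (map (innerSum n R F) (chains n F))) ((n ∸ ∣ F ∣) !) {{(n ∸ ∣ F ∣) !≢0}}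

-- Σ_{i=a}^{b} f i over rationals (empty if b < a)
sumFromTo : ℕ → ℕ → (ℕ → ℚ) → ℚ
sumFromTo a b f = foldr _+ℚ_ 0ℚ (map (λ k → f (a + k)) (upTo (suc b ∸ a)))

NoForbidden : {n : ℕ} → (Subset n → Bool) → Set
NoForbidden R = ∀ B C' D → R B ≡ true → R C' ≡ true → R D ≡ true →
  B ≢ C' → B ≢ D → C' ≢ D → B ⊂ D → ∣ B ∣ ≡ ∣ C' ∣ → ⊥
  where open import Relation.Binary.PropositionalEquality using (_≢_)
        open import Data.Empty using (⊥)

module Submission where

-- Write chainWeight q A k for the sum, over the chains A ⊂ C₁ ⊂ … ⊂ C_k = [n],
-- of q(C₁) + … + q(C_k), where q is the weight restricted to admissible X.  Splitting
-- off the first step C₁ = x gives the recursion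
--     chainWeight q A (k+1) = Σ_{x covers A} (q x · #chains(x) + chainWeight q x k),
-- with k! chains from x.  If at most one cover of A is in ℛ, this is at most
-- binom(n, |A|+1) k! + (k+1)β, where β bounds the chain weight from a cover.  If two
-- covers x ≠ y of A are in ℛ, then the forbidden configuration shows that no member of
-- ℛ lies strictly above x, so x contributes only q x and the total is ≤ (k+1)(α ⊔ β).
-- Induction along these bounds gives binom(n, |A|+1) per chain in the upper half
-- (|A| ≥ m - 1), and in the lower half a recursively defined lowerBound which, divided
-- by the number of chains, telescopes into binom(n, m) + Σ binom(n, i)/(n - i + 1).

open import Data.Bool using (Bool; true; false; _∧_; not)
import Data.Bool.Properties as BoolP
open import Data.Nat using (ℕ; zero; suc; _+_; _*_; _∸_; _≤_; _<_; _≥_; z≤n; s≤s; _⊔_; _!; NonZero)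
import Data.Nat.Properties as ℕP
open import Data.Nat.Combinatorics
  using (_C_; nCk≡n!/k![n-k]!; k![n∸k]!∣n!; k>n⇒nCk≡0; [n-k]*[n-k-1]!≡[n-k]!)
open import Data.Nat.DivMod using (m/n*n≡m)
open import Relation.Binary.Definitions using (tri<; tri≈; tri>)
open import Data.Nat.ListAction using (sum)
open import Data.List using (List; []; _∷_; _++_; map; concatMap; concat; filter; foldr; upTo; applyUpTo)
import Data.List as List
open import Data.Product using (_×_; _,_; proj₁; proj₂; ∃)
open import Data.Unit using (tt)
open import Data.Maybe using (just)
open import Data.List.Properties using (map-applyUpTo)
import Data.Maybe.Properties as MaybeP
open import Data.Empty using (⊥; ⊥-elim)
open import Data.Vec using ([]; _∷_; here; there)
open import Data.Fin using () renaming (zero to fzero; suc to fsuc)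
open import Data.Fin.Subset using (Subset; _⊆_; _⊂_; ∣_∣) renaming (⊤ to full)
open import Data.Fin.Subset.Properties using (drop-there; drop-∷-⊆; p⊆q⇒∣p∣≤∣q∣; _⊂?_; ∣p∣≤n)
open import Relation.Binary.PropositionalEquality
open import Relation.Nullary using (Dec; yes; no; does)
open import Relation.Nullary.Decidable using (dec-true; _×-dec_)
open import Function using (_∘_)
open import Data.Nat.Solver using (module +-*-Solver)
open import Defs
open import Algebra.Properties.CommutativeSemigroup ℕP.+-commutativeSemigroup
  using () renaming (interchange to +-interchange)

∑ : {A : Set} → List A → (A → ℕ) → ℕ
∑ xs f = sum (map f xs)

syntax ∑ xs (λ x → e) = ∑[ x ∈ xs ] e

⟦_⟧_ : Bool → ℕ → ℕ
⟦ true ⟧ v = v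
⟦ false ⟧ v = 0

module _ {A : Set} where

  ∑-++ : ∀ (xs ys : List A) f → ∑ (xs ++ ys) f ≡ ∑ xs f + ∑ ys f
  ∑-++ [] ys f = refl
  ∑-++ (x ∷ xs) ys f = trans (cong (f x +_) (∑-++ xs ys f)) (sym (ℕP.+-assoc (f x) _ _))

  ∑-cong : ∀ (xs : List A) {f g} → (∀ x → f x ≡ g x) → ∑ xs f ≡ ∑ xs g
  ∑-cong [] eq = refl
  ∑-cong (x ∷ xs) eq = cong₂ _+_ (eq x) (∑-cong xs eq)

  ∑-mono : ∀ (xs : List A) {f g} → (∀ x → f x ≤ g x) → ∑ xs f ≤ ∑ xs g
  ∑-mono [] le = z≤n
  ∑-mono (x ∷ xs) le = ℕP.+-mono-≤ (le x) (∑-mono xs le)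

  ∑-+ : ∀ (xs : List A) f g → ∑[ x ∈ xs ] (f x + g x) ≡ ∑ xs f + ∑ xs g
  ∑-+ [] f g = refl
  ∑-+ (x ∷ xs) f g = trans (cong (f x + g x +_) (∑-+ xs f g)) (+-interchange (f x) (g x) _ _)

  ∑-* : ∀ (xs : List A) c f → ∑[ x ∈ xs ] (c * f x) ≡ c * ∑ xs f
  ∑-* [] c f = sym (ℕP.*-zeroʳ c)
  ∑-* (x ∷ xs) c f = trans (cong (c * f x +_) (∑-* xs c f)) (sym (ℕP.*-distribˡ-+ c (f x) _))

  ∑-0 : ∀ (xs : List A) → ∑[ x ∈ xs ] 0 ≡ 0
  ∑-0 [] = refl
  ∑-0 (x ∷ xs) = ∑-0 xs

  ∑-⟦⟧ : ∀ (xs : List A) b f → ∑[ x ∈ xs ] ⟦ b ⟧ f x ≡ ⟦ b ⟧ ∑ xs f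
  ∑-⟦⟧ xs true f = refl
  ∑-⟦⟧ xs false f = ∑-0 xs

  ∑-filter : ∀ {P : A → Set} (P? : ∀ x → Dec (P x)) (xs : List A) f →
             ∑ (filter P? xs) f ≡ ∑[ x ∈ xs ] ⟦ does (P? x) ⟧ f x
  ∑-filter P? [] f = refl
  ∑-filter P? (x ∷ xs) f with does (P? x)
  ... | true = cong (f x +_) (∑-filter P? xs f)
  ... | false = ∑-filter P? xs f

  ∑-pos : ∀ (xs : List A) f → 0 < ∑ xs f → ∃ λ x → 0 < f x
  ∑-pos [] f ()
  ∑-pos (x ∷ xs) f pos with f x in eq
  ... | suc _ = x , subst (0 <_) (sym eq) (s≤s z≤n)
  ... | zero = ∑-pos xs f pos

∑-map : ∀ {A B : Set} (g : A → B) (xs : List A) f → ∑ (map g xs) f ≡ ∑[ x ∈ xs ] f (g x)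
∑-map g [] f = refl
∑-map g (x ∷ xs) f = cong (f (g x) +_) (∑-map g xs f)

∑-concatMap : ∀ {A B : Set} (h : A → List B) (xs : List A) f →
              ∑ (concatMap h xs) f ≡ ∑[ x ∈ xs ] ∑ (h x) f
∑-concatMap h [] f = refl
∑-concatMap h (x ∷ xs) f =
  trans (∑-++ (h x) (concat (map h xs)) f) (cong (∑ (h x) f +_) (∑-concatMap h xs f))

⟦⟧-∧ : ∀ a b v → ⟦ a ∧ b ⟧ v ≡ ⟦ a ⟧ ⟦ b ⟧ v
⟦⟧-∧ true b v = refl
⟦⟧-∧ false b v = refl

⟦⟧-+ : ∀ b u v → ⟦ b ⟧ (u + v) ≡ ⟦ b ⟧ u + ⟦ b ⟧ v
⟦⟧-+ true u v = refl
⟦⟧-+ false u v = refl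

⟦⟧-* : ∀ b v → ⟦ b ⟧ v ≡ v * ⟦ b ⟧ 1
⟦⟧-* true v = sym (ℕP.*-identityʳ v)
⟦⟧-* false v = sym (ℕP.*-zeroʳ v)

⟦⟧-≤ : ∀ b v → ⟦ b ⟧ v ≤ v
⟦⟧-≤ true v = ℕP.≤-refl
⟦⟧-≤ false v = z≤n

⟦⟧-mono : ∀ b {u v} → (b ≡ true → u ≤ v) → ⟦ b ⟧ u ≤ ⟦ b ⟧ v
⟦⟧-mono true le = le refl
⟦⟧-mono false le = z≤n

⟦⟧-pos : ∀ b v → 0 < ⟦ b ⟧ v → b ≡ true
⟦⟧-pos true v _ = refl
⟦⟧-pos false v ()

∧-true : ∀ {a b} → a ∧ b ≡ true → a ≡ true × b ≡ true
∧-true {true} {true} refl = refl , refl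

does-reflects : ∀ {P : Set} (P? : Dec P) (b : Bool) → (P → b ≡ true) → (b ≡ true → P) → does P? ≡ b
does-reflects (yes p) b to from = sym (to p)
does-reflects (no ¬p) true to from = ⊥-elim (¬p (from refl))
does-reflects (no ¬p) false to from = refl

-- Boolean tests on subsets of [n]: equality, and the covering relation
-- "y arises from x by adding one element", which is the step of a chain.

_==_ : {n : ℕ} → Subset n → Subset n → Bool
x == y = does (x ≟S y)

==-refl : ∀ {n} (x : Subset n) → x == x ≡ true
==-refl x = dec-true (x ≟S x) refl

==-sound : ∀ {n} (x y : Subset n) → x == y ≡ true → x ≡ y
==-sound x y eq with x ≟S y
... | yes x≡y = x≡y

covers : {n : ℕ} → Subset n → Subset n → Bool
covers [] [] = false
covers (false ∷ x) (false ∷ y) = covers x y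
covers (true ∷ x) (true ∷ y) = covers x y
covers (false ∷ x) (true ∷ y) = x == y
covers (true ∷ x) (false ∷ y) = false

⊆-∷ : ∀ {n} {a b : Bool} {x y : Subset n} → (a ≡ true → b ≡ true) → x ⊆ y → (a ∷ x) ⊆ (b ∷ y)
⊆-∷ {a = true} {true} a⇒b x⊆y here = here
⊆-∷ {a = true} {false} a⇒b x⊆y here with a⇒b refl
... | ()
⊆-∷ a⇒b x⊆y (there p) = there (x⊆y p)

covers-sound : ∀ {n} (x y : Subset n) → covers x y ≡ true → x ⊂ y × ∣ y ∣ ≡ suc ∣ x ∣
covers-sound [] [] ()
covers-sound (true ∷ x) (false ∷ y) ()
covers-sound (false ∷ x) (false ∷ y) c with covers-sound x y c
... | (x⊆y , i , i∈y , i∉x) , card = (⊆-∷ (λ ()) x⊆y , fsuc i , there i∈y , i∉x ∘ drop-there) , card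
covers-sound (true ∷ x) (true ∷ y) c with covers-sound x y c
... | (x⊆y , i , i∈y , i∉x) , card = (⊆-∷ (λ _ → refl) x⊆y , fsuc i , there i∈y , i∉x ∘ drop-there) , cong suc card
covers-sound (false ∷ x) (true ∷ y) c with ==-sound x y c
... | refl = (⊆-∷ (λ _ → refl) (λ p → p) , fzero , here , λ ()) , refl

⊆-∣∣-== : ∀ {n} (x y : Subset n) → x ⊆ y → ∣ y ∣ ≡ ∣ x ∣ → x == y ≡ true
⊆-∣∣-== x y x⊆y card = dec-true (x ≟S y) (⊆-∣∣-≡ x y x⊆y card)
  where
  ⊆-∣∣-≡ : ∀ {n} (x y : Subset n) → x ⊆ y → ∣ y ∣ ≡ ∣ x ∣ → x ≡ y
  ⊆-∣∣-≡ [] [] _ _ = refl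
  ⊆-∣∣-≡ (false ∷ x) (false ∷ y) s c = cong (false ∷_) (⊆-∣∣-≡ x y (drop-∷-⊆ s) c)
  ⊆-∣∣-≡ (true ∷ x) (true ∷ y) s c = cong (true ∷_) (⊆-∣∣-≡ x y (drop-∷-⊆ s) (ℕP.suc-injective c))
  ⊆-∣∣-≡ (false ∷ x) (true ∷ y) s c = ⊥-elim (ℕP.<⇒≱ (ℕP.≤-reflexive c) (p⊆q⇒∣p∣≤∣q∣ (drop-∷-⊆ s)))
  ⊆-∣∣-≡ (true ∷ x) (false ∷ y) s c with s here
  ... | ()

covers-complete : ∀ {n} (x y : Subset n) → x ⊆ y → ∣ y ∣ ≡ suc ∣ x ∣ → covers x y ≡ true
covers-complete [] [] s ()
covers-complete (false ∷ x) (false ∷ y) s c = covers-complete x y (drop-∷-⊆ s) c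
covers-complete (true ∷ x) (true ∷ y) s c = covers-complete x y (drop-∷-⊆ s) (ℕP.suc-injective c)
covers-complete (false ∷ x) (true ∷ y) s c = ⊆-∣∣-== x y (drop-∷-⊆ s) (ℕP.suc-injective c)
covers-complete (true ∷ x) (false ∷ y) s c with s here
... | ()

∑-allSubsets-suc : ∀ n (f : Subset (suc n) → ℕ) →
  ∑ (allSubsets (suc n)) f ≡ ∑[ y ∈ allSubsets n ] f (false ∷ y) + ∑[ y ∈ allSubsets n ] f (true ∷ y)
∑-allSubsets-suc n f = trans (∑-++ (map (false ∷_) All) (map (true ∷_) All) f)
                             (cong₂ _+_ (∑-map (false ∷_) All f) (∑-map (true ∷_) All f))
  where All = allSubsets n

∑-point : ∀ n (x : Subset n) (h : Subset n → ℕ) → ∑[ y ∈ allSubsets n ] ⟦ x == y ⟧ h y ≡ h x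
∑-point zero [] h = ℕP.+-identityʳ (h [])
∑-point (suc n) (a ∷ x) h = trans (∑-allSubsets-suc n (λ y → ⟦ (a ∷ x) == y ⟧ h y)) (by-head a)
  where
  All = allSubsets n
  by-head : ∀ a → ∑[ y ∈ All ] ⟦ (a ∷ x) == (false ∷ y) ⟧ h (false ∷ y)
                + ∑[ y ∈ All ] ⟦ (a ∷ x) == (true ∷ y) ⟧ h (true ∷ y) ≡ h (a ∷ x)
  by-head false = trans (cong₂ _+_ (∑-point n x (λ y → h (false ∷ y))) (∑-0 All)) (ℕP.+-identityʳ _)
  by-head true = cong₂ _+_ (∑-0 All) (∑-point n x (λ y → h (true ∷ y)))

covers-count : ∀ n (x : Subset n) → ∑[ y ∈ allSubsets n ] ⟦ covers x y ⟧ 1 + ∣ x ∣ ≡ n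
covers-count zero [] = refl
covers-count (suc n) (a ∷ x) =
  trans (cong (_+ ∣ a ∷ x ∣) (∑-allSubsets-suc n (λ y → ⟦ covers (a ∷ x) y ⟧ 1))) (by-head a)
  where
  All = allSubsets n
  coversₓ = ∑[ y ∈ All ] ⟦ covers x y ⟧ 1
  by-head : ∀ a → ∑[ y ∈ All ] ⟦ covers (a ∷ x) (false ∷ y) ⟧ 1
                + ∑[ y ∈ All ] ⟦ covers (a ∷ x) (true ∷ y) ⟧ 1 + ∣ a ∷ x ∣ ≡ suc n
  by-head false = begin
      coversₓ + ∑[ y ∈ All ] ⟦ x == y ⟧ 1 + ∣ x ∣  ≡⟨ cong (λ z → coversₓ + z + ∣ x ∣) (∑-point n x (λ _ → 1)) ⟩
      coversₓ + 1 + ∣ x ∣                         ≡⟨ cong (_+ ∣ x ∣) (ℕP.+-comm coversₓ 1) ⟩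
      suc (coversₓ + ∣ x ∣)                       ≡⟨ cong suc (covers-count n x) ⟩
      suc n                                       ∎
    where open ≡-Reasoning
  by-head true = begin
      ∑[ y ∈ All ] 0 + coversₓ + suc ∣ x ∣  ≡⟨ cong (λ z → z + coversₓ + suc ∣ x ∣) (∑-0 All) ⟩
      coversₓ + suc ∣ x ∣                   ≡⟨ ℕP.+-suc coversₓ ∣ x ∣ ⟩
      suc (coversₓ + ∣ x ∣)                 ≡⟨ cong suc (covers-count n x) ⟩
      suc n                                 ∎
    where open ≡-Reasoning

-- Chains as lists of covering steps.  reachesFull x c holds when x followed by
-- c is a sequence of covering steps ending at [n]; chainCount A k counts such
-- continuations c of length k, and chainWeight q A k sums q over their members.

reachesFull : ∀ {n} → Subset n → List (Subset n) → Bool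
reachesFull x [] = x == full
reachesFull x (y ∷ c) = covers x y ∧ reachesFull y c

reachesFull-sound : ∀ {n} (x : Subset n) c → reachesFull x c ≡ true →
                    List.last (x ∷ c) ≡ just full × Path (x ∷ c)
reachesFull-sound x [] r = cong just (==-sound x full r) , tt
reachesFull-sound x (y ∷ c) r with ∧-true {covers x y} r
... | step , rest with covers-sound x y step | reachesFull-sound y c rest
... | (x⊂y , card) | last≡ , path = last≡ , (proj₁ x⊂y , card) , path

reachesFull-complete : ∀ {n} (x : Subset n) c → List.last (x ∷ c) ≡ just full → Path (x ∷ c) →
                       reachesFull x c ≡ true
reachesFull-complete {n} x [] last≡ _ rewrite MaybeP.just-injective last≡ = ==-refl {n} full
reachesFull-complete x (y ∷ c) last≡ ((x⊆y , card) , path)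
  rewrite covers-complete x y x⊆y card = reachesFull-complete y c last≡ path

isChain-does : ∀ {n} (F x : Subset n) c → does (isChain? F full (x ∷ c)) ≡ (F == x) ∧ reachesFull x c
isChain-does F x c = does-reflects (isChain? F full (x ∷ c)) _ to from
  where
  to : IsChain F full (x ∷ c) → (F == x) ∧ reachesFull x c ≡ true
  to (head≡ , last≡ , path) rewrite MaybeP.just-injective head≡ | ==-refl F =
    reachesFull-complete F c last≡ path
  from : (F == x) ∧ reachesFull x c ≡ true → IsChain F full (x ∷ c)
  from r with ∧-true {F == x} r
  ... | F≡x , reaches with reachesFull-sound x c reaches
  ... | last≡ , path = cong just (sym (==-sound F x F≡x)) , last≡ , path

chainCount : ∀ {n} → Subset n → ℕ → ℕ
chainCount {n} A k = ∑[ c ∈ listsOf k (allSubsets n) ] ⟦ reachesFull A c ⟧ 1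

chainWeight : ∀ {n} → (Subset n → ℕ) → Subset n → ℕ → ℕ
chainWeight {n} q A k = ∑[ c ∈ listsOf k (allSubsets n) ] ⟦ reachesFull A c ⟧ ∑ c q

module _ {n : ℕ} where

  private All = allSubsets n

  ∑-listsOf-suc : ∀ k (A : Subset n) (f : List (Subset n) → ℕ) →
    ∑[ c ∈ listsOf (suc k) All ] ⟦ reachesFull A c ⟧ f c
    ≡ ∑[ x ∈ All ] ⟦ covers A x ⟧ ∑[ c ∈ listsOf k All ] ⟦ reachesFull x c ⟧ f (x ∷ c)
  ∑-listsOf-suc k A f = begin
      ∑ (concatMap (λ x → map (x ∷_) Ls) All) g
    ≡⟨ ∑-concatMap (λ x → map (x ∷_) Ls) All g ⟩
      ∑[ x ∈ All ] ∑ (map (x ∷_) Ls) g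
    ≡⟨ ∑-cong All (λ x → ∑-map (x ∷_) Ls g) ⟩
      ∑[ x ∈ All ] ∑[ c ∈ Ls ] ⟦ covers A x ∧ reachesFull x c ⟧ f (x ∷ c)
    ≡⟨ ∑-cong All (λ x → ∑-cong Ls (λ c → ⟦⟧-∧ (covers A x) (reachesFull x c) (f (x ∷ c)))) ⟩
      ∑[ x ∈ All ] ∑[ c ∈ Ls ] ⟦ covers A x ⟧ ⟦ reachesFull x c ⟧ f (x ∷ c)
    ≡⟨ ∑-cong All (λ x → ∑-⟦⟧ Ls (covers A x) _) ⟩
      ∑[ x ∈ All ] ⟦ covers A x ⟧ ∑[ c ∈ Ls ] ⟦ reachesFull x c ⟧ f (x ∷ c) ∎
    where
    open ≡-Reasoning
    Ls = listsOf k All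
    g = λ c → ⟦ reachesFull A c ⟧ f c

  chainCount-suc : ∀ (A : Subset n) k →
                   chainCount A (suc k) ≡ ∑[ x ∈ All ] ⟦ covers A x ⟧ chainCount x k
  chainCount-suc A k = ∑-listsOf-suc k A (λ _ → 1)

  chainWeight-suc : ∀ (q : Subset n → ℕ) (A : Subset n) k → chainWeight q A (suc k)
    ≡ ∑[ x ∈ All ] ⟦ covers A x ⟧ (q x * chainCount x k + chainWeight q x k)
  chainWeight-suc q A k = trans (∑-listsOf-suc k A (λ c → ∑ c q))
    (∑-cong All (λ x → cong (⟦ covers A x ⟧_) (split x)))
    where
    Ls = listsOf k All
    split : ∀ x → ∑[ c ∈ Ls ] ⟦ reachesFull x c ⟧ (q x + ∑ c q) ≡ q x * chainCount x k + chainWeight q x k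
    split x = begin
        ∑[ c ∈ Ls ] ⟦ reachesFull x c ⟧ (q x + ∑ c q)
      ≡⟨ ∑-cong Ls (λ c → ⟦⟧-+ (reachesFull x c) (q x) (∑ c q)) ⟩
        ∑[ c ∈ Ls ] (⟦ reachesFull x c ⟧ q x + ⟦ reachesFull x c ⟧ ∑ c q)
      ≡⟨ ∑-+ Ls _ _ ⟩
        ∑[ c ∈ Ls ] ⟦ reachesFull x c ⟧ q x + chainWeight q x k
      ≡⟨ cong (_+ chainWeight q x k) (∑-cong Ls (λ c → ⟦⟧-* (reachesFull x c) (q x))) ⟩
        ∑[ c ∈ Ls ] (q x * ⟦ reachesFull x c ⟧ 1) + chainWeight q x k
      ≡⟨ cong (_+ chainWeight q x k) (∑-* Ls (q x) _) ⟩
        q x * chainCount x k + chainWeight q x k ∎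
      where open ≡-Reasoning

  covers-count′ : ∀ (A : Subset n) k → ∣ A ∣ + suc k ≡ n → ∑[ y ∈ All ] ⟦ covers A y ⟧ 1 ≡ suc k
  covers-count′ A k size = ℕP.+-cancelʳ-≡ ∣ A ∣ _ _
    (trans (covers-count n A) (trans (sym size) (ℕP.+-comm ∣ A ∣ (suc k))))

  covers-size : ∀ (A x : Subset n) k → covers A x ≡ true → ∣ A ∣ + suc k ≡ n → ∣ x ∣ + k ≡ n
  covers-size A x k c size =
    trans (cong (_+ k) (proj₂ (covers-sound A x c))) (trans (sym (ℕP.+-suc ∣ A ∣ k)) size)

  chainCount-≤ : ∀ k (A : Subset n) → ∣ A ∣ + k ≡ n → chainCount A k ≤ k !
  chainCount-≤ zero A size = ℕP.+-mono-≤ (⟦⟧-≤ (A == full) 1) z≤n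
  chainCount-≤ (suc k) A size = begin
      chainCount A (suc k)                       ≡⟨ chainCount-suc A k ⟩
      ∑[ x ∈ All ] ⟦ covers A x ⟧ chainCount x k ≤⟨ ∑-mono All (λ x → ⟦⟧-mono (covers A x) (IH x)) ⟩
      ∑[ x ∈ All ] ⟦ covers A x ⟧ (k !)          ≡⟨ ∑-cong All (λ x → ⟦⟧-* (covers A x) (k !)) ⟩
      ∑[ x ∈ All ] (k ! * ⟦ covers A x ⟧ 1)      ≡⟨ ∑-* All (k !) _ ⟩
      k ! * ∑[ x ∈ All ] ⟦ covers A x ⟧ 1        ≡⟨ cong (k ! *_) (covers-count′ A k size) ⟩
      k ! * suc k                                ≡⟨ ℕP.*-comm (k !) (suc k) ⟩
      suc k !                                    ∎
    where
    open ℕP.≤-Reasoning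
    IH : ∀ x → covers A x ≡ true → chainCount x k ≤ k !
    IH x c = chainCount-≤ k x (covers-size A x k c size)

module Numerator (n : ℕ) (R : Subset n → Bool) (F : Subset n) where

  admissible? : (X : Subset n) → Dec (R X ≡ true × F ⊂ X × X ⊂ full)
  admissible? X = (R X BoolP.≟ true) ×-dec ((F ⊂? X) ×-dec (X ⊂? full))

  admissibleWeight : Subset n → ℕ
  admissibleWeight X = ⟦ does (admissible? X) ⟧ w n X

  admissibleWeight-≤ : ∀ X → admissibleWeight X ≤ ⟦ R X ⟧ w n X
  admissibleWeight-≤ X with R X
  ... | true = ⟦⟧-≤ _ _
  ... | false = z≤n

  admissibleWeight-F : admissibleWeight F ≡ 0
  admissibleWeight-F = cong (⟦_⟧ w n F) (does-reflects (admissible? F) false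
    (λ { (_ , (_ , i , i∈F , i∉F) , _) → ⊥-elim (i∉F i∈F) }) (λ ()))

  numerator≡chainWeight :
    sum (map (innerSum n R F) (chains n F)) ≡ chainWeight admissibleWeight F (n ∸ ∣ F ∣)
  numerator≡chainWeight = begin
      ∑ (filter (isChain? F full) (concatMap (λ x → map (x ∷_) Ls) All)) (innerSum n R F)
    ≡⟨ ∑-filter (isChain? F full) (concatMap (λ x → map (x ∷_) Ls) All) (innerSum n R F) ⟩
      ∑ (concatMap (λ x → map (x ∷_) Ls) All) (λ c → ⟦ does (isChain? F full c) ⟧ innerSum n R F c)
    ≡⟨ ∑-concatMap (λ x → map (x ∷_) Ls) All _ ⟩
      ∑[ x ∈ All ] ∑ (map (x ∷_) Ls) (λ c → ⟦ does (isChain? F full c) ⟧ innerSum n R F c)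
    ≡⟨ ∑-cong All (λ x → ∑-map (x ∷_) Ls _) ⟩
      ∑[ x ∈ All ] ∑[ c ∈ Ls ] ⟦ does (isChain? F full (x ∷ c)) ⟧ innerSum n R F (x ∷ c)
    ≡⟨ ∑-cong All (λ x → ∑-cong Ls (λ c → trans (cong (⟦_⟧ innerSum n R F (x ∷ c)) (isChain-does F x c))
                                              (⟦⟧-∧ (F == x) (reachesFull x c) _))) ⟩
      ∑[ x ∈ All ] ∑[ c ∈ Ls ] ⟦ F == x ⟧ ⟦ reachesFull x c ⟧ innerSum n R F (x ∷ c)
    ≡⟨ ∑-cong All (λ x → ∑-⟦⟧ Ls (F == x) _) ⟩
      ∑[ x ∈ All ] ⟦ F == x ⟧ ∑[ c ∈ Ls ] ⟦ reachesFull x c ⟧ innerSum n R F (x ∷ c)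
    ≡⟨ ∑-point n F (λ x → ∑[ c ∈ Ls ] ⟦ reachesFull x c ⟧ innerSum n R F (x ∷ c)) ⟩
      ∑[ c ∈ Ls ] ⟦ reachesFull F c ⟧ innerSum n R F (F ∷ c)
    ≡⟨ ∑-cong Ls (λ c → cong (⟦ reachesFull F c ⟧_) (innerSum-F c)) ⟩
      chainWeight admissibleWeight F (n ∸ ∣ F ∣) ∎
    where
    open ≡-Reasoning
    All = allSubsets n
    Ls = listsOf (n ∸ ∣ F ∣) All
    innerSum-F : ∀ c → innerSum n R F (F ∷ c) ≡ ∑ c admissibleWeight
    innerSum-F c = trans (∑-filter admissible? (F ∷ c) (w n)) (cong (_+ ∑ c admissibleWeight) admissibleWeight-F)

binom-factorials : ∀ {n k} → k ≤ n → (n C k) * (k ! * (n ∸ k) !) ≡ n !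
binom-factorials {n} {k} k≤n = trans (cong (_* (k ! * (n ∸ k) !)) (nCk≡n!/k![n-k]! k≤n))
                                     (m/n*n≡m {{k ℕP.!* (n ∸ k) !≢0}} (k![n∸k]!∣n! k≤n))

binom-suc : ∀ n j → (n C suc j) * suc j ≡ (n C j) * (n ∸ j)
binom-suc n j with ℕP.<-cmp j n
... | tri< j<n _ _ = ℕP.*-cancelʳ-≡ _ _ (j ! * (n ∸ suc j) !) {{j ℕP.!* (n ∸ suc j) !≢0}}
                       (trans via-suc (sym via-j))
  where
  open +-*-Solver
  via-suc : (n C suc j) * suc j * (j ! * (n ∸ suc j) !) ≡ n !
  via-suc = trans (solve 4 (λ a b c d → a :* b :* (c :* d) := a :* ((b :* c) :* d)) refl
                     (n C suc j) (suc j) (j !) ((n ∸ suc j) !))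
                  (binom-factorials j<n)
  via-j : (n C j) * (n ∸ j) * (j ! * (n ∸ suc j) !) ≡ n !
  via-j = trans (solve 4 (λ a b c d → a :* b :* (c :* d) := a :* (c :* (b :* d))) refl
                   (n C j) (n ∸ j) (j !) ((n ∸ suc j) !))
                (trans (cong (λ z → (n C j) * (j ! * z)) ([n-k]*[n-k-1]!≡[n-k]! j<n))
                       (binom-factorials (ℕP.<⇒≤ j<n)))
... | tri≈ _ refl _ = trans (cong (_* suc j) (k>n⇒nCk≡0 {n} {suc j} (ℕP.n<1+n n)))
                            (sym (trans (cong ((n C j) *_) (ℕP.n∸n≡0 n)) (ℕP.*-zeroʳ (n C j))))
... | tri> _ _ j>n = trans (cong (_* suc j) (k>n⇒nCk≡0 {n} {suc j} (ℕP.m<n⇒m<1+n j>n)))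
                           (sym (trans (cong ((n C j) *_) (ℕP.m≤n⇒m∸n≡0 (ℕP.<⇒≤ j>n))) (ℕP.*-zeroʳ (n C j))))

binom-increasing : ∀ n j → suc j + j ≤ n → n C j ≤ n C suc j
binom-increasing n j le = ℕP.*-cancelʳ-≤ _ _ (suc j)
  (ℕP.≤-trans (ℕP.*-monoʳ-≤ (n C j) j<n∸j) (ℕP.≤-reflexive (sym (binom-suc n j))))
  where
  j<n∸j : suc j ≤ n ∸ j
  j<n∸j = subst (_≤ n ∸ j) (ℕP.m+n∸n≡m (suc j) j) (ℕP.∸-monoˡ-≤ j le)

binom-≤-middle : ∀ m e j → j + e ≡ m → (m + m) C j ≤ (m + m) C m
binom-≤-middle m zero j j≡m = ℕP.≤-reflexive (cong ((m + m) C_) (trans (sym (ℕP.+-identityʳ j)) j≡m))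
binom-≤-middle m (suc e) j j+e≡m =
  ℕP.≤-trans (binom-increasing (m + m) j (ℕP.+-mono-≤ j<m (ℕP.≤-trans (ℕP.n≤1+n j) j<m)))
             (binom-≤-middle m e (suc j) (trans (sym (ℕP.+-suc j e)) j+e≡m))
  where
  j<m : suc j ≤ m
  j<m = subst (suc j ≤_) j+e≡m (subst (_≤ j + suc e) (ℕP.+-comm j 1) (ℕP.+-monoʳ-≤ j (s≤s z≤n)))

-- The bound for the lower half: lowerBound n m d bounds the chain weight of a set
-- of size m - 1 - d, spread over its (m + 1 + d)! chains (see chainWeight-lower).
lowerBound : (n m : ℕ) → ℕ → ℕ
lowerBound n m zero = (n C m) * (suc m) !
lowerBound n m (suc d) = (n C (m ∸ suc d)) * (suc m + d) ! + suc (suc m + d) * lowerBound n m d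

lowerBound-≥ : ∀ n m d → (n C m) * (suc m + d) ! ≤ lowerBound n m d
lowerBound-≥ n m zero = ℕP.≤-reflexive (cong (λ z → (n C m) * z !) (ℕP.+-identityʳ (suc m)))
lowerBound-≥ n m (suc d) = begin
    (n C m) * (suc m + suc d) !  ≡⟨ cong (λ z → (n C m) * z !) (ℕP.+-suc (suc m) d) ⟩
    (n C m) * (suc K * K !)      ≡⟨ solve 3 (λ c j f → c :* (j :* f) := j :* (c :* f)) refl (n C m) (suc K) (K !) ⟩
    suc K * ((n C m) * K !)      ≤⟨ ℕP.*-monoʳ-≤ (suc K) (lowerBound-≥ n m d) ⟩
    suc K * lowerBound n m d     ≤⟨ ℕP.m≤n+m (suc K * lowerBound n m d) ((n C (m ∸ suc d)) * K !) ⟩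
    lowerBound n m (suc d)       ∎
  where
  open ℕP.≤-Reasoning
  open +-*-Solver
  K = suc m + d

lower-size : ∀ m′ n → n ≡ suc m′ + suc m′ → ∀ a d → a + d ≡ m′ → a + (suc (suc m′) + d) ≡ n
lower-size m′ n n≡m+m a d a+d≡m′ = begin
    a + (suc m + d)  ≡⟨ solve 3 (λ a d x → a :+ ((con 2 :+ x) :+ d) := (a :+ d) :+ (con 2 :+ x)) refl a d m′ ⟩
    (a + d) + suc m  ≡⟨ cong (_+ suc m) a+d≡m′ ⟩
    m′ + suc m       ≡⟨ ℕP.+-suc m′ m ⟩
    m + m            ≡⟨ sym n≡m+m ⟩
    n                ∎
  where
  open ≡-Reasoning
  open +-*-Solver
  m = suc m′

module ChainBounds {n : ℕ} (R : Subset n → Bool) (noForbidden : NoForbidden R)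
                   (q : Subset n → ℕ) (q≤w : ∀ X → q X ≤ ⟦ R X ⟧ w n X) where

  private All = allSubsets n

  q-outside : ∀ X → R X ≡ false → q X ≡ 0
  q-outside X r = ℕP.n≤0⇒n≡0 (subst (λ b → q X ≤ ⟦ b ⟧ w n X) r (q≤w X))

  -- Twins kill chains: if x ≠ y are members of ℛ of the same size, no member of ℛ
  -- lies strictly above x, so every chain from x carries weight 0.
  module _ {x y : Subset n} (x∈R : R x ≡ true) (y∈R : R y ≡ true) (x≢y : x ≢ y) (∣x∣≡∣y∣ : ∣ x ∣ ≡ ∣ y ∣) where

    above-twin-weightless : ∀ z c → x ⊆ z → ∣ x ∣ ≤ ∣ z ∣ → reachesFull z c ≡ true → ∑ c q ≡ 0
    above-twin-weightless z [] x⊆z _ _ = refl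
    above-twin-weightless z (X ∷ c) x⊆z ∣x∣≤∣z∣ r with ∧-true {covers z X} r
    ... | z⋖X , rest with covers-sound z X z⋖X
    ... | (z⊆X , i , i∈X , i∉z) , card =
      cong₂ _+_ (q-outside X X∉R) (above-twin-weightless X c (proj₁ x⊂X) (ℕP.<⇒≤ ∣x∣<∣X∣) rest)
      where
      x⊂X : x ⊂ X
      x⊂X = z⊆X ∘ x⊆z , i , i∈X , i∉z ∘ x⊆z
      ∣x∣<∣X∣ : ∣ x ∣ < ∣ X ∣
      ∣x∣<∣X∣ = subst (∣ x ∣ <_) (sym card) (s≤s ∣x∣≤∣z∣)
      X∉R : R X ≡ false
      X∉R with R X in X∈R
      ... | false = refl
      ... | true = ⊥-elim (noForbidden x y X x∈R y∈R X∈R x≢y (λ { refl → i∉z (x⊆z i∈X) })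
                     (λ { refl → ℕP.<-irrefl ∣x∣≡∣y∣ ∣x∣<∣X∣ }) x⊂X ∣x∣≡∣y∣)

    twin-weightless : ∀ k → chainWeight q x k ≡ 0
    twin-weightless k = trans (∑-cong (listsOf k All) term) (∑-0 (listsOf k All))
      where
      term : ∀ c → ⟦ reachesFull x c ⟧ ∑ c q ≡ 0
      term c with reachesFull x c in r
      ... | true = above-twin-weightless x c (λ p → p) ℕP.≤-refl r
      ... | false = refl

  coversInR : Subset n → Subset n → Bool
  coversInR A y = covers A y ∧ R y

  twin-exists : ∀ A x → coversInR A x ≡ true → 2 ≤ ∑[ y ∈ All ] ⟦ coversInR A y ⟧ 1 →
                ∃ λ y → coversInR A y ≡ true × x ≢ y
  twin-exists A x x∈ two with ∑-pos All others (ℕP.+-cancelˡ-≤ 1 _ _ (ℕP.≤-trans two split))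
    where
    others = λ y → ⟦ coversInR A y ∧ not (x == y) ⟧ 1
    by-cases : ∀ b e → ⟦ b ⟧ 1 ≤ ⟦ e ⟧ 1 + ⟦ b ∧ not e ⟧ 1
    by-cases true true = s≤s z≤n
    by-cases true false = s≤s z≤n
    by-cases false e = z≤n
    split : ∑[ y ∈ All ] ⟦ coversInR A y ⟧ 1 ≤ 1 + ∑ All others
    split = ℕP.≤-trans (∑-mono All (λ y → by-cases (coversInR A y) (x == y)))
              (ℕP.≤-reflexive (trans (∑-+ All _ _) (cong (_+ ∑ All others) (∑-point n x (λ _ → 1)))))
  ... | y , pos with ∧-true {coversInR A y} (⟦⟧-pos _ 1 pos)
  ... | y∈ , x≠y = y , y∈ , λ { refl → x≠x (==-refl x) x≠y }
    where
    x≠x : ∀ {b} → b ≡ true → not b ≡ true → ⊥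
    x≠x {true} _ ()

  module _ (A : Subset n) (k : ℕ) (size : ∣ A ∣ + suc k ≡ n)
           (β : ℕ) (IH : ∀ x → covers A x ≡ true → chainWeight q x k ≤ β) where

    -- α bounds what a single cover x contributes through its own weight q x,
    -- summed over the k! chains continuing from x.
    α : ℕ
    α = (n C suc ∣ A ∣) * k !

    own-≤ : ∀ x → covers A x ≡ true → q x * chainCount x k ≤ ⟦ R x ⟧ α
    own-≤ x c = ℕP.≤-trans (ℕP.*-mono-≤ q≤ (chainCount-≤ k x (covers-size A x k c size))) (by-cases (R x))
      where
      q≤ : q x ≤ ⟦ R x ⟧ (n C suc ∣ A ∣)
      q≤ = subst (λ s → q x ≤ ⟦ R x ⟧ (n C s)) (proj₂ (covers-sound A x c)) (q≤w x)
      by-cases : ∀ b → ⟦ b ⟧ (n C suc ∣ A ∣) * k ! ≤ ⟦ b ⟧ α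
      by-cases true = ℕP.≤-refl
      by-cases false = z≤n

    -- At most one cover of A lies in ℛ: its own weight plus β per cover.
    chainWeight-sparse : ∑[ y ∈ All ] ⟦ coversInR A y ⟧ 1 ≤ 1 → chainWeight q A (suc k) ≤ α + suc k * β
    chainWeight-sparse ≤1 = begin
        chainWeight q A (suc k)
      ≡⟨ chainWeight-suc q A k ⟩
        ∑[ x ∈ All ] ⟦ covers A x ⟧ (q x * chainCount x k + chainWeight q x k)
      ≤⟨ ∑-mono All term ⟩
        ∑[ x ∈ All ] (α * ⟦ coversInR A x ⟧ 1 + β * ⟦ covers A x ⟧ 1)
      ≡⟨ trans (∑-+ All _ _) (cong₂ _+_ (∑-* All α _) (∑-* All β _)) ⟩
        α * ∑[ x ∈ All ] ⟦ coversInR A x ⟧ 1 + β * ∑[ x ∈ All ] ⟦ covers A x ⟧ 1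
      ≤⟨ ℕP.+-mono-≤ (ℕP.*-monoʳ-≤ α ≤1) (ℕP.≤-reflexive (cong (β *_) (covers-count′ A k size))) ⟩
        α * 1 + β * suc k
      ≡⟨ cong₂ _+_ (ℕP.*-identityʳ α) (ℕP.*-comm β (suc k)) ⟩
        α + suc k * β ∎
      where
      open ℕP.≤-Reasoning
      term : ∀ x → ⟦ covers A x ⟧ (q x * chainCount x k + chainWeight q x k)
                 ≤ α * ⟦ coversInR A x ⟧ 1 + β * ⟦ covers A x ⟧ 1
      term x with covers A x in c
      ... | false = z≤n
      ... | true = ℕP.+-mono-≤ (ℕP.≤-trans (own-≤ x c) (ℕP.≤-reflexive (⟦⟧-* (R x) α)))
                               (ℕP.≤-trans (IH x c) (ℕP.≤-reflexive (sym (ℕP.*-identityʳ β))))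

    -- At least two covers of A lie in ℛ: each of them has a twin, so it
    -- contributes only its own weight; every cover contributes at most α ⊔ β.
    chainWeight-dense : 2 ≤ ∑[ y ∈ All ] ⟦ coversInR A y ⟧ 1 → chainWeight q A (suc k) ≤ suc k * (α ⊔ β)
    chainWeight-dense two = begin
        chainWeight q A (suc k)
      ≡⟨ chainWeight-suc q A k ⟩
        ∑[ x ∈ All ] ⟦ covers A x ⟧ (q x * chainCount x k + chainWeight q x k)
      ≤⟨ ∑-mono All (λ x → ℕP.≤-trans (⟦⟧-mono (covers A x) (term x)) (ℕP.≤-reflexive (⟦⟧-* (covers A x) (α ⊔ β)))) ⟩
        ∑[ x ∈ All ] ((α ⊔ β) * ⟦ covers A x ⟧ 1)
      ≡⟨ ∑-* All (α ⊔ β) _ ⟩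
        (α ⊔ β) * ∑[ x ∈ All ] ⟦ covers A x ⟧ 1
      ≡⟨ trans (cong ((α ⊔ β) *_) (covers-count′ A k size)) (ℕP.*-comm (α ⊔ β) (suc k)) ⟩
        suc k * (α ⊔ β) ∎
      where
      open ℕP.≤-Reasoning
      term : ∀ x → covers A x ≡ true → q x * chainCount x k + chainWeight q x k ≤ α ⊔ β
      term x c with R x in r
      ... | false = ℕP.≤-trans (ℕP.≤-reflexive (cong (λ v → v * chainCount x k + chainWeight q x k) (q-outside x r)))
                               (ℕP.≤-trans (IH x c) (ℕP.m≤n⊔m α β))
      ... | true with twin-exists A x (subst (λ b → b ∧ R x ≡ true) (sym c) r) two
      ... | y , y∈ , x≢y with ∧-true {covers A y} y∈
      ... | A⋖y , y∈R = ℕP.≤-trans (ℕP.+-mono-≤ (subst (λ b → q x * chainCount x k ≤ ⟦ b ⟧ α) r (own-≤ x c))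
                                                 (ℕP.≤-reflexive (twin-weightless r y∈R x≢y ∣x∣≡∣y∣ k)))
                                   (ℕP.≤-trans (ℕP.≤-reflexive (ℕP.+-identityʳ α)) (ℕP.m≤m⊔n α β))
        where
        ∣x∣≡∣y∣ : ∣ x ∣ ≡ ∣ y ∣
        ∣x∣≡∣y∣ = trans (proj₂ (covers-sound A x c)) (sym (proj₂ (covers-sound A y A⋖y)))

    chainWeight-step : ∀ Bd → α + suc k * β ≤ Bd → suc k * α ≤ Bd → chainWeight q A (suc k) ≤ Bd
    chainWeight-step Bd sparse≤ dense≤ with ∑[ y ∈ All ] ⟦ coversInR A y ⟧ 1 ℕP.≤? 1
    ... | yes ≤1 = ℕP.≤-trans (chainWeight-sparse ≤1) sparse≤
    ... | no ≰1 = ℕP.≤-trans (chainWeight-dense (ℕP.≰⇒> ≰1))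
        (subst (_≤ Bd) (sym (ℕP.*-distribˡ-⊔ (suc k) α β))
          (ℕP.⊔-lub dense≤ (ℕP.≤-trans (ℕP.m≤n+m (suc k * β) α) sparse≤)))

  -- The sparse bound is the binding one, via
  -- (k+1) binom(n, |A|+2) ≤ k binom(n, |A|+1) for k = n - |A| - 1 ≤ |A| + 1.
  chainWeight-upper : ∀ k (A : Subset n) → ∣ A ∣ + k ≡ n → n ≤ suc ∣ A ∣ + suc ∣ A ∣ →
                      chainWeight q A k ≤ (n C suc ∣ A ∣) * k !
  chainWeight-upper zero A size upper = ℕP.+-mono-≤ (⟦⟧-≤ (A == full) 0) z≤n
  chainWeight-upper (suc k) A size upper =
    chainWeight-step A k size (C₂ * k !) IH (C₁ * suc k !) sparse≤ dense≤
    where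
    a = ∣ A ∣
    C₁ = n C suc a
    C₂ = n C suc (suc a)
    IH : ∀ x → covers A x ≡ true → chainWeight q x k ≤ C₂ * k !
    IH x c = subst (λ s → chainWeight q x k ≤ (n C suc s) * k !) ∣x∣≡
               (chainWeight-upper k x (covers-size A x k c size)
                 (ℕP.≤-trans upper (ℕP.≤-trans (ℕP.+-mono-≤ (ℕP.n≤1+n (suc a)) (ℕP.n≤1+n (suc a)))
                   (ℕP.≤-reflexive (cong (λ s → suc s + suc s) (sym ∣x∣≡))))))
      where ∣x∣≡ = proj₂ (covers-sound A x c)
    n∸a≡k : n ∸ suc a ≡ k
    n∸a≡k = trans (cong (_∸ suc a) (trans (sym size) (ℕP.+-suc a k))) (ℕP.m+n∸m≡n (suc a) k)
    k≤a+1 : k ≤ suc a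
    k≤a+1 = ℕP.+-cancelˡ-≤ (suc a) k (suc a)
              (ℕP.≤-trans (ℕP.≤-reflexive (trans (sym (ℕP.+-suc a k)) size)) upper)
    shrink : suc k * C₂ ≤ k * C₁
    shrink = ℕP.≤-trans (ℕP.*-monoˡ-≤ C₂ (s≤s k≤a+1)) (ℕP.≤-reflexive (begin
      suc (suc a) * C₂  ≡⟨ ℕP.*-comm (suc (suc a)) C₂ ⟩
      C₂ * suc (suc a)  ≡⟨ binom-suc n (suc a) ⟩
      C₁ * (n ∸ suc a)  ≡⟨ cong (C₁ *_) n∸a≡k ⟩
      C₁ * k            ≡⟨ ℕP.*-comm C₁ k ⟩
      k * C₁            ∎))
      where open ≡-Reasoning
    sparse≤ : C₁ * k ! + suc k * (C₂ * k !) ≤ C₁ * suc k !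
    sparse≤ = begin
        C₁ * k ! + suc k * (C₂ * k !)  ≡⟨ cong (C₁ * k ! +_) (sym (ℕP.*-assoc (suc k) C₂ (k !))) ⟩
        C₁ * k ! + suc k * C₂ * k !    ≤⟨ ℕP.+-monoʳ-≤ (C₁ * k !) (ℕP.*-monoˡ-≤ (k !) shrink) ⟩
        C₁ * k ! + k * C₁ * k !        ≡⟨ solve 3 (λ c f j → c :* f :+ j :* c :* f := c :* (f :+ j :* f)) refl C₁ (k !) k ⟩
        C₁ * suc k !                   ∎
      where
      open ℕP.≤-Reasoning
      open +-*-Solver
    dense≤ : suc k * (C₁ * k !) ≤ C₁ * suc k !
    dense≤ = ℕP.≤-reflexive (solve 3 (λ j c f → j :* (c :* f) := c :* (j :* f)) refl (suc k) C₁ (k !))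
      where open +-*-Solver

  -- Lower half, for n = 2m with m = m′ + 1: a set of size m - 1 - d carries chain
  -- weight at most lowerBound n m d; the middle layer binom(n, m) dominates the
  -- dense case.
  module _ (m′ : ℕ) (n≡m+m : n ≡ suc m′ + suc m′) where

    private m = suc m′

    chainWeight-lower : ∀ d (A : Subset n) → ∣ A ∣ + d ≡ m′ → chainWeight q A (suc m + d) ≤ lowerBound n m d
    chainWeight-lower zero A a≡m′ =
      ℕP.≤-trans (chainWeight-upper (suc m + 0) A (lower-size m′ n n≡m+m ∣ A ∣ 0 a≡m′)
                   (ℕP.≤-reflexive (trans n≡m+m (cong (λ s → suc s + suc s) (sym ∣A∣≡m′)))))
                 (ℕP.≤-reflexive (cong₂ (λ s t → (n C s) * t !) (cong suc ∣A∣≡m′) (ℕP.+-identityʳ (suc m))))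
      where
      ∣A∣≡m′ : ∣ A ∣ ≡ m′
      ∣A∣≡m′ = trans (sym (ℕP.+-identityʳ ∣ A ∣)) a≡m′
    chainWeight-lower (suc d) A a+d≡m′ =
      subst (λ k → chainWeight q A k ≤ lowerBound n m (suc d)) (sym (ℕP.+-suc (suc m) d))
        (chainWeight-step A K size (lowerBound n m d) IH (lowerBound n m (suc d)) sparse≤ dense≤)
      where
      a = ∣ A ∣
      K = suc m + d
      a+1+d≡m′ : suc a + d ≡ m′
      a+1+d≡m′ = trans (sym (ℕP.+-suc a d)) a+d≡m′
      size : a + suc K ≡ n
      size = trans (cong (a +_) (sym (ℕP.+-suc (suc m) d))) (lower-size m′ n n≡m+m a (suc d) a+d≡m′)
      IH : ∀ x → covers A x ≡ true → chainWeight q x K ≤ lowerBound n m d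
      IH x c = chainWeight-lower d x (trans (cong (_+ d) (proj₂ (covers-sound A x c))) a+1+d≡m′)
      sparse≤ : (n C suc a) * K ! + suc K * lowerBound n m d ≤ lowerBound n m (suc d)
      sparse≤ = ℕP.≤-reflexive (cong (λ s → (n C s) * K ! + suc K * lowerBound n m d)
                  (sym (trans (cong (_∸ d) (sym a+1+d≡m′)) (ℕP.m+n∸n≡m (suc a) d))))
      dense≤ : suc K * ((n C suc a) * K !) ≤ lowerBound n m (suc d)
      dense≤ = begin
          suc K * ((n C suc a) * K !)  ≡⟨ solve 3 (λ j c f → j :* (c :* f) := c :* (j :* f)) refl (suc K) (n C suc a) (K !) ⟩
          (n C suc a) * (suc K * K !)  ≤⟨ ℕP.*-monoˡ-≤ (suc K * K !) below-middle ⟩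
          (n C m) * (suc K * K !)      ≡⟨ cong (λ z → (n C m) * z !) (sym (ℕP.+-suc (suc m) d)) ⟩
          (n C m) * (suc m + suc d) !  ≤⟨ lowerBound-≥ n m (suc d) ⟩
          lowerBound n m (suc d)       ∎
        where
        open ℕP.≤-Reasoning
        open +-*-Solver
        below-middle : n C suc a ≤ n C m
        below-middle = subst (λ z → z C suc a ≤ z C m) (sym n≡m+m)
                         (binom-≤-middle m (suc d) (suc a) (cong suc a+d≡m′))

-- Fractions of naturals.  (Integers are imported only here: their constructor +_
-- would clash with the sections (x +_) of natural-number addition used above.)

open import Data.Integer as ℤ using (+_)
import Data.Integer.Properties as ℤP
open import Data.Rational as ℚ using (ℚ; _/_; toℚᵘ; 0ℚ) renaming (_≤_ to _≤ℚ_; _+_ to _+ℚ_)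
import Data.Rational.Properties as ℚP
import Data.Rational.Unnormalised as ℚᵘ
import Data.Rational.Unnormalised.Properties as ℚᵘP

_/!_ : ℕ → ℕ → ℚ
a /! k = ((+ a) / k !) {{k ℕP.!≢0}}

toℚᵘ-/ : ∀ a d .{{_ : NonZero d}} → toℚᵘ ((+ a) / d) ℚᵘ.≃ ((+ a) ℚᵘ./ d)
toℚᵘ-/ a (suc d) = ℚP.toℚᵘ-fromℚᵘ (ℚᵘ.mkℚᵘ (+ a) d)

fracᵘ-≤ : ∀ a b d e .{{_ : NonZero d}} .{{_ : NonZero e}} →
          a * e ≤ b * d → ((+ a) ℚᵘ./ d) ℚᵘ.≤ ((+ b) ℚᵘ./ e)
fracᵘ-≤ a b (suc d) (suc e) le =
  ℚᵘ.*≤* (subst₂ ℤ._≤_ (ℤP.pos-* a (suc e)) (ℤP.pos-* b (suc d)) (ℤ.+≤+ le))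

frac-≤ : ∀ a b d e .{{_ : NonZero d}} .{{_ : NonZero e}} →
         a * e ≤ b * d → (+ a) / d ≤ℚ (+ b) / e
frac-≤ a b d e le = ℚP.toℚᵘ-cancel-≤
  (ℚᵘP.≤-respˡ-≃ (ℚᵘP.≃-sym (toℚᵘ-/ a d))
  (ℚᵘP.≤-respʳ-≃ (ℚᵘP.≃-sym (toℚᵘ-/ b e)) (fracᵘ-≤ a b d e le)))

frac-≤-+ : ∀ a b c D d e .{{_ : NonZero D}} .{{_ : NonZero d}} .{{_ : NonZero e}} →
           a * (d * e) ≤ (b * e + c * d) * D → (+ a) / D ≤ℚ (+ b) / d +ℚ (+ c) / e
frac-≤-+ a b c D (suc d) (suc e) le = ℚP.toℚᵘ-cancel-≤
  (ℚᵘP.≤-respˡ-≃ (ℚᵘP.≃-sym (toℚᵘ-/ a D))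
  (ℚᵘP.≤-respʳ-≃ (ℚᵘP.≃-sym (ℚP.toℚᵘ-homo-+ ((+ b) / suc d) ((+ c) / suc e)))
  (ℚᵘP.≤-respʳ-≃ (ℚᵘP.+-cong (ℚᵘP.≃-sym (toℚᵘ-/ b (suc d))) (ℚᵘP.≃-sym (toℚᵘ-/ c (suc e))))
  (subst (((+ a) ℚᵘ./ D) ℚᵘ.≤_) sum-as-fraction (fracᵘ-≤ a _ D (suc d * suc e) le)))))
  where
  sum-as-fraction : (+ (b * suc e + c * suc d)) ℚᵘ./ (suc d * suc e)
                  ≡ ((+ b) ℚᵘ./ suc d) ℚᵘ.+ ((+ c) ℚᵘ./ suc e)
  sum-as-fraction = cong₂ ℚᵘ.mkℚᵘ (cong₂ ℤ._+_ (ℤP.pos-* b (suc e)) (ℤP.pos-* c (suc d))) refl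

applyUpTo-cong : ∀ {A : Set} {f g : ℕ → A} j → (∀ k → f k ≡ g k) → applyUpTo f j ≡ applyUpTo g j
applyUpTo-cong zero f≗g = refl
applyUpTo-cong (suc j) f≗g = cong₂ _∷_ (f≗g 0) (applyUpTo-cong j (f≗g ∘ suc))

sumFromTo-empty : ∀ a b f → b < a → sumFromTo a b f ≡ 0ℚ
sumFromTo-empty a b f b<a = cong (λ j → foldr _+ℚ_ 0ℚ (map (λ k → f (a + k)) (upTo j))) (ℕP.m≤n⇒m∸n≡0 b<a)

sumFromTo-unfold : ∀ a b f → a ≤ b → sumFromTo a b f ≡ f a +ℚ sumFromTo (suc a) b f
sumFromTo-unfold a b f a≤b = begin
    foldr _+ℚ_ 0ℚ (map (λ k → f (a + k)) (upTo (suc b ∸ a)))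
  ≡⟨ cong (λ j → foldr _+ℚ_ 0ℚ (map (λ k → f (a + k)) (upTo j))) (ℕP.+-∸-assoc 1 a≤b) ⟩
    f (a + 0) +ℚ foldr _+ℚ_ 0ℚ (map (λ k → f (a + k)) (applyUpTo suc (b ∸ a)))
  ≡⟨ cong₂ (λ x l → x +ℚ foldr _+ℚ_ 0ℚ l) (cong f (ℕP.+-identityʳ a)) shift ⟩
    f a +ℚ sumFromTo (suc a) b f ∎
  where
  open ≡-Reasoning
  j = b ∸ a
  shift : map (λ k → f (a + k)) (applyUpTo suc j) ≡ map (λ k → f (suc a + k)) (upTo j)
  shift = trans (map-applyUpTo suc (λ k → f (a + k)) j)
            (trans (applyUpTo-cong j (λ k → cong f (ℕP.+-suc a k))) (sym (map-applyUpTo (λ k → k) _ j)))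

module _ (m′ n : ℕ) (n≡m+m : n ≡ suc m′ + suc m′) where

  private
    m = suc m′
    g : ℕ → ℚ
    g i = (+ (n C i)) / suc (n ∸ i)

  -- The recursion of lowerBound, cross-multiplied for a comparison of fractions.
  lowerBound-cross : ∀ d f → suc f + d ≡ m′ → let K = suc m + d in
    lowerBound n m (suc d) * (suc (n ∸ suc f) * K !)
    ≡ ((n C suc f) * K ! + lowerBound n m d * suc (n ∸ suc f)) * (suc m + suc d) !
  lowerBound-cross d f f+1+d≡m′ = begin
      ((n C (m ∸ suc d)) * K ! + suc K * lowerBound n m d) * (suc (n ∸ suc f) * K !)
    ≡⟨ cong₂ (λ i j → ((n C i) * K ! + suc K * lowerBound n m d) * (suc j * K !)) m∸d≡f+1 n∸f≡K ⟩
      ((n C suc f) * K ! + suc K * lowerBound n m d) * (suc K * K !)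
    ≡⟨ solve 4 (λ b e j c → (b :* e :+ j :* c) :* (j :* e) := (b :* e :+ c :* j) :* (j :* e)) refl
         (n C suc f) (K !) (suc K) (lowerBound n m d) ⟩
      ((n C suc f) * K ! + lowerBound n m d * suc K) * (suc K * K !)
    ≡⟨ cong₂ (λ j l → ((n C suc f) * K ! + lowerBound n m d * suc j) * l)
         (sym n∸f≡K) (cong _! (sym (ℕP.+-suc (suc m) d))) ⟩
      ((n C suc f) * K ! + lowerBound n m d * suc (n ∸ suc f)) * (suc m + suc d) ! ∎
    where
    open ≡-Reasoning
    open +-*-Solver
    K = suc m + d
    m∸d≡f+1 : m ∸ suc d ≡ suc f
    m∸d≡f+1 = trans (cong (_∸ d) (sym f+1+d≡m′)) (ℕP.m+n∸n≡m (suc f) d)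
    n∸f≡K : n ∸ suc f ≡ K
    n∸f≡K = trans (cong (_∸ suc f) (sym (lower-size m′ n n≡m+m (suc f) d f+1+d≡m′))) (ℕP.m+n∸m≡n (suc f) K)

  lowerBound-ℚ : ∀ d f → f + d ≡ m′ →
    lowerBound n m d /! (suc m + d) ≤ℚ (+ (n C m)) / 1 +ℚ sumFromTo (suc f) m′ g
  lowerBound-ℚ zero f f≡m′ = subst (lowerBound n m 0 /! (suc m + 0) ≤ℚ_) (sym no-sum)
    (frac-≤ (lowerBound n m 0) (n C m) ((suc m + 0) !) 1 {{(suc m + 0) ℕP.!≢0}}
      (ℕP.≤-reflexive (trans (ℕP.*-identityʳ _) (cong (λ z → (n C m) * z !) (sym (ℕP.+-identityʳ (suc m)))))))
    where
    no-sum : (+ (n C m)) / 1 +ℚ sumFromTo (suc f) m′ g ≡ (+ (n C m)) / 1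
    no-sum = trans (cong ((+ (n C m)) / 1 +ℚ_)
                     (sumFromTo-empty (suc f) m′ g (s≤s (ℕP.≤-reflexive (sym (trans (sym (ℕP.+-identityʳ f)) f≡m′))))))
                   (ℚP.+-identityʳ _)
  lowerBound-ℚ (suc d) f f+d≡m′ = begin
      lowerBound n m (suc d) /! (suc m + suc d)
    ≤⟨ frac-≤-+ (lowerBound n m (suc d)) (n C suc f) (lowerBound n m d) ((suc m + suc d) !) (suc (n ∸ suc f)) (K !) {{(suc m + suc d) ℕP.!≢0}} {{_}} {{K ℕP.!≢0}}
         (ℕP.≤-reflexive (lowerBound-cross d f f+1+d≡m′)) ⟩
      g (suc f) +ℚ lowerBound n m d /! K
    ≤⟨ ℚP.+-monoʳ-≤ (g (suc f)) (lowerBound-ℚ d (suc f) f+1+d≡m′) ⟩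
      g (suc f) +ℚ ((+ (n C m)) / 1 +ℚ sumFromTo (suc (suc f)) m′ g)
    ≡⟨ ℚP.+-comm (g (suc f)) _ ⟩
      ((+ (n C m)) / 1 +ℚ sumFromTo (suc (suc f)) m′ g) +ℚ g (suc f)
    ≡⟨ ℚP.+-assoc ((+ (n C m)) / 1) _ _ ⟩
      (+ (n C m)) / 1 +ℚ (sumFromTo (suc (suc f)) m′ g +ℚ g (suc f))
    ≡⟨ cong ((+ (n C m)) / 1 +ℚ_) (trans (ℚP.+-comm _ (g (suc f))) (sym (sumFromTo-unfold (suc f) m′ g f<m′))) ⟩
      (+ (n C m)) / 1 +ℚ sumFromTo (suc f) m′ g ∎
    where
    open ℚP.≤-Reasoning
    K = suc m + d
    f+1+d≡m′ : suc f + d ≡ m′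
    f+1+d≡m′ = trans (sym (ℕP.+-suc f d)) f+d≡m′
    f<m′ : suc f ≤ m′
    f<m′ = subst (suc f ≤_) f+1+d≡m′ (ℕP.m≤m+n (suc f) d)

S-≤ : ∀ n R (F : Subset n) B e .{{_ : NonZero e}} → let k = n ∸ ∣ F ∣ in
      chainWeight (Numerator.admissibleWeight n R F) F k * e ≤ B * k ! → S n R F ≤ℚ (+ B) / e
S-≤ n R F B e le = frac-≤ (sum (map (innerSum n R F) (chains n F))) B ((n ∸ ∣ F ∣) !) e {{(n ∸ ∣ F ∣) ℕP.!≢0}}
  (subst (λ N → N * e ≤ B * (n ∸ ∣ F ∣) !) (sym (Numerator.numerator≡chainWeight n R F)) le)

lemma2p19 : (m : ℕ) → let n = 2 * m in
    (F : Subset n) → F ⊂ full →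
    (R : Subset n → Bool) → NoForbidden R →
    (∣ F ∣ ≥ m ∸ 1 → S n R F ≤ℚ (+ (n C suc ∣ F ∣)) / 1)
    × (∣ F ∣ ≤ m ∸ 1 →
    S n R F ≤ℚ ((+ (n C m)) / 1 +ℚ sumFromTo (suc ∣ F ∣) (m ∸ 1) (λ i → (+ (n C i)) / suc (n ∸ i))))
lemma2p19 zero F (_ , () , _) R noForbidden
lemma2p19 (suc m′) F _ R noForbidden = upper-half , lower-half
  where
  m = suc m′
  n = 2 * m
  k = n ∸ ∣ F ∣
  open Numerator n R F using (admissibleWeight; admissibleWeight-≤)
  open ChainBounds R noForbidden admissibleWeight admissibleWeight-≤
  n≡m+m : n ≡ m + m
  n≡m+m = cong (λ j → m + j) (ℕP.+-identityʳ m)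
  upper-half : ∣ F ∣ ≥ m′ → S n R F ≤ℚ (+ (n C suc ∣ F ∣)) / 1
  upper-half m′≤∣F∣ = S-≤ n R F (n C suc ∣ F ∣) 1 (ℕP.≤-trans (ℕP.≤-reflexive (ℕP.*-identityʳ _))
    (chainWeight-upper k F (ℕP.m+[n∸m]≡n (∣p∣≤n F)) (subst (_≤ (suc ∣ F ∣) + (suc ∣ F ∣)) (sym n≡m+m) (ℕP.+-mono-≤ (s≤s m′≤∣F∣) (s≤s m′≤∣F∣)))))
  lower-half : ∣ F ∣ ≤ m′ → S n R F ≤ℚ ((+ (n C m)) / 1 +ℚ sumFromTo (suc ∣ F ∣) m′ (λ i → (+ (n C i)) / suc (n ∸ i)))
  lower-half ∣F∣≤m′ = ℚP.≤-trans
    (S-≤ n R F (lowerBound n m d) (K !) {{K ℕP.!≢0}} (subst (λ j → chainWeight admissibleWeight F j * K ! ≤ lowerBound n m d * j !) (sym k≡K)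
      (ℕP.*-monoˡ-≤ (K !) (chainWeight-lower m′ n≡m+m d F ∣F∣+d≡m′))))
    (lowerBound-ℚ m′ n n≡m+m d ∣ F ∣ ∣F∣+d≡m′)
    where
    d = m′ ∸ ∣ F ∣
    K = suc m + d
    ∣F∣+d≡m′ = ℕP.m+[n∸m]≡n ∣F∣≤m′
    k≡K : k ≡ K
    k≡K = trans (cong (_∸ ∣ F ∣) (sym (lower-size m′ n n≡m+m ∣ F ∣ d ∣F∣+d≡m′))) (ℕP.m+n∸m≡n ∣ F ∣ K)
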